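{- For all integers $n\geq 2$, $$\det(1;T_0,T_1,\ldots,T_{n-1})=(-1)^{n-1}F_{n-2},$$ and for all integers $n\geq 1$, $$\det(1;T_2,T_3,\ldots,T_{n+1})=(-1)^{n-1}P_{n+2}.$$
   Context: The tribonacci numbers are defined by $T_0=T_1=0$, $T_2=1$, $T_n=T_{n-1}+T_{n-2}+T_{n-3}$ for $n\geq3$. The Fibonacci numbers are $F_0=0$, $F_1=1$, $F_n=F_{n-1}+F_{n-2}$ for $n\ge2$. The Padovan numbers are $P_0=1$, $P_1=P_2=0$, $P_n=P_{n-2}+P_{n-3}$ for $n\geq 3$. For numbers $a_0,a_1,\ldots,a_n$, $\det(a_0;a_1,\ldots,a_n)$ denotes the determinant of the $n\times n$ Toeplitz--Hessenberg matrix whose $(i,j)$ entry is $a_{i-j+1}$ if $i-j+1\ge 0$ and $0$ otherwise (so $a_1$ is on the main diagonal, $a_0$ on the superdiagonal, $a_k$ on the $(k-1)$-th subdiagonal, and all entries above the superdiagonal are $0$). -}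

module Defs where

open import Data.Nat as ℕ using (ℕ; zero; suc)
open import Data.Integer as ℤ using (ℤ; +_; -_; _+_; _*_)
open import Data.Fin using (Fin; zero; suc; toℕ; punchIn)
open import Relation.Nullary using (yes; no)

sumFin : ∀ m → (Fin m → ℤ) → ℤ
sumFin zero f = + 0
sumFin (suc m) f = f zero + sumFin m (λ k → f (suc k))

sign : ℕ → ℤ
sign zero = + 1
sign (suc k) = - sign k

minor : ∀ {n} → Fin (suc n) → (Fin (suc n) → Fin (suc n) → ℤ) → Fin n → Fin n → ℤ
minor j M r c = M (suc r) (punchIn j c)

det : ∀ n → (Fin n → Fin n → ℤ) → ℤ
det zero M = + 1
det (suc n) M = sumFin (suc n) (λ j → sign (toℕ j) * M zero j * det n (minor j M))

toeplitzHessenberg : (ℕ → ℤ) → (n : ℕ) → Fin n → Fin n → ℤ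
toeplitzHessenberg a n i j with toℕ j ℕ.≤? suc (toℕ i)
... | yes _ = a (suc (toℕ i) ℕ.∸ toℕ j)
... | no _ = + 0

detTH : (ℕ → ℤ) → ℕ → ℤ
detTH a n = det n (toeplitzHessenberg a n)

trib : ℕ → ℤ
trib 0 = + 0
trib 1 = + 0
trib 2 = + 1
trib (suc (suc (suc n))) = trib (suc (suc n)) + trib (suc n) + trib n

fib : ℕ → ℤ
fib 0 = + 0
fib 1 = + 1
fib (suc (suc n)) = fib (suc n) + fib n

pad : ℕ → ℤ
pad 0 = + 1
pad 1 = + 0
pad 2 = + 0
pad (suc (suc (suc n))) = pad (suc n) + pad n

withHead1 : (ℕ → ℤ) → ℕ → ℤ
withHead1 s zero = + 1
withHead1 s (suc k) = s k

module Submission where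

-- Fix a sequence a with a₀ = 1 and, for any sequence b, let
-- G b m be the determinant of the m×m Toeplitz–Hessenberg matrix of a whose
-- first column is replaced by (b₀, …, b_{m-1}).  Taking b = (a₁, a₂, …)
-- recovers det(a₀; a₁, …, a_m).  The first row of the bordered matrix is
-- (b₀, 1, 0, …, 0), so Laplace expansion along it gives
--     G b (m+2) = b₀ · det(a₀; a₁, …, a_{m+1}) − G (b ∘ suc) (m+1),
-- and G b m is additive in b.  For b a tail of the tribonacci sequence,
-- the shifted sequences satisfy the tribonacci recurrence, so additivity
-- turns the expansion into a closed system of recurrences for the values
-- G (T ∘ suc^k) m.  A simultaneous induction then identifies these values
-- with signed Fibonacci numbers (for a = (1; T₀, T₁, …)) and with signed
-- Padovan numbers (for a = (1; T₂, T₃, …)).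

open import Defs
open import Data.Nat using (ℕ; zero; suc; _+_; _∸_; _≤_; _≤?_; z≤n; s≤s)
open import Data.Nat.Properties using (+-comm)
open import Data.Integer using (ℤ; +_; -_; _*_; _-_)
import Data.Integer as ℤ
open import Data.Integer.Tactic.RingSolver using (solve-∀)
open import Data.Fin using (Fin; zero; suc; toℕ; punchIn)
open import Data.Product using (_×_; _,_; proj₁)
open import Data.Empty using (⊥-elim)
open import Relation.Nullary using (yes; no; ¬_)
open import Relation.Binary.PropositionalEquality
  using (_≡_; refl; sym; trans; cong; cong₂; module ≡-Reasoning)
open ≡-Reasoning

sumFin-cong : ∀ m {f g : Fin m → ℤ} → (∀ k → f k ≡ g k) → sumFin m f ≡ sumFin m g
sumFin-cong zero    eq = refl
sumFin-cong (suc m) eq = cong₂ ℤ._+_ (eq zero) (sumFin-cong m (λ k → eq (suc k)))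

sumFin-zero : ∀ m {f : Fin m → ℤ} → (∀ k → f k ≡ + 0) → sumFin m f ≡ + 0
sumFin-zero zero    eq = refl
sumFin-zero (suc m) eq =
  cong₂ ℤ._+_ (eq zero) (sumFin-zero m (λ k → eq (suc k)))

det-cong : ∀ n {M N : Fin n → Fin n → ℤ} → (∀ i j → M i j ≡ N i j) → det n M ≡ det n N
det-cong zero    eq = refl
det-cong (suc n) eq = sumFin-cong (suc n) λ j →
  cong₂ _*_ (cong (sign (toℕ j) *_) (eq zero j))
            (det-cong n (λ r c → eq (suc r) (punchIn j c)))

shift : (ℕ → ℤ) → ℕ → ℤ
shift b k = b (suc k)

module Bordered (a : ℕ → ℤ) (a₀≡1 : a 0 ≡ + 1) where

  -- Entry (i, j) of the Toeplitz–Hessenberg matrix of a, by structural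
  -- recursion, so that deleting the first row and column is definitional.
  entry : ℕ → ℕ → ℤ
  entry i             zero          = a (suc i)
  entry zero          (suc zero)    = a 0
  entry zero          (suc (suc j)) = + 0
  entry (suc i)       (suc j)       = entry i j

  entry-below : ∀ i j → j ≤ suc i → entry i j ≡ a (suc i ∸ j)
  entry-below i       zero          _         = refl
  entry-below zero    (suc zero)    _         = refl
  entry-below zero    (suc (suc j)) (s≤s ())
  entry-below (suc i) (suc j)       (s≤s j≤i) = entry-below i j j≤i

  entry-above : ∀ i j → ¬ (j ≤ suc i) → entry i j ≡ + 0
  entry-above i       zero          j≰ = ⊥-elim (j≰ z≤n)
  entry-above zero    (suc zero)    j≰ = ⊥-elim (j≰ (s≤s z≤n))
  entry-above zero    (suc (suc j)) j≰ = refl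
  entry-above (suc i) (suc j)       j≰ = entry-above i j (λ j≤i → j≰ (s≤s j≤i))

  entry-correct : ∀ n (i j : Fin n) → toeplitzHessenberg a n i j ≡ entry (toℕ i) (toℕ j)
  entry-correct n i j with toℕ j ≤? suc (toℕ i)
  ... | yes j≤ = sym (entry-below _ _ j≤)
  ... | no  j≰ = sym (entry-above _ _ j≰)

  bordered : (ℕ → ℤ) → ∀ {n} → Fin n → Fin n → ℤ
  bordered b r zero    = b (toℕ r)
  bordered b r (suc c) = entry (toℕ r) (suc (toℕ c))

  G : (ℕ → ℤ) → ℕ → ℤ
  G b m = det m (bordered b {m})

  tail : ℕ → ℤ
  tail = shift a

  detTH≡G : ∀ n → detTH a n ≡ G tail n
  detTH≡G n = det-cong n λ i j → trans (entry-correct n i j) (first-column i j)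
    where
    first-column : ∀ i j → entry (toℕ i) (toℕ j) ≡ bordered tail i j
    first-column i zero    = refl
    first-column i (suc j) = refl

  G-one : ∀ b → G b 1 ≡ b 0
  G-one b = identity (b 0)
    where
    identity : ∀ x → + 1 * x * + 1 ℤ.+ + 0 ≡ x
    identity = solve-∀

  minor₀ : ∀ {m} b (r c : Fin (suc m)) → minor zero (bordered b) r c ≡ bordered tail r c
  minor₀ b r zero    = refl
  minor₀ b r (suc c) = refl

  minor₁ : ∀ {m} b (r c : Fin (suc m)) →
           minor (suc zero) (bordered b) r c ≡ bordered (shift b) r c
  minor₁ b r zero    = refl
  minor₁ b r (suc c) = refl

  -- Laplace expansion along the first row (b₀, 1, 0, …, 0).
  expand : ∀ m b → G b (suc (suc m)) ≡ b 0 * G tail (suc m) - G (shift b) (suc m)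
  expand m b = begin
    G b (suc (suc m))
      ≡⟨ cong₂ ℤ._+_ (cong (sign 0 * b 0 *_) (det-cong (suc m) (minor₀ b)))
           (cong₂ ℤ._+_ (cong₂ (λ u v → sign 1 * u * v) a₀≡1 (det-cong (suc m) (minor₁ b)))
             (sumFin-zero m (λ k → zero-entry (sign (toℕ (suc (suc k))))
                                               (det (suc m) (minor (suc (suc k)) (bordered b)))))) ⟩
    + 1 * b 0 * G tail (suc m) ℤ.+ (- + 1 * + 1 * G (shift b) (suc m) ℤ.+ + 0)
      ≡⟨ collect (b 0) (G tail (suc m)) (G (shift b) (suc m)) ⟩
    b 0 * G tail (suc m) - G (shift b) (suc m) ∎
    where
    zero-entry : ∀ s d → s * + 0 * d ≡ + 0
    zero-entry = solve-∀
    collect : ∀ x D E → + 1 * x * D ℤ.+ (- + 1 * + 1 * E ℤ.+ + 0) ≡ x * D - E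
    collect = solve-∀

  additive : ∀ m (b c e : ℕ → ℤ) → (∀ k → e k ≡ b k ℤ.+ c k) →
             G e (suc m) ≡ G b (suc m) ℤ.+ G c (suc m)
  additive zero b c e eq = begin
    G e 1             ≡⟨ G-one e ⟩
    e 0               ≡⟨ eq 0 ⟩
    b 0 ℤ.+ c 0       ≡⟨ sym (cong₂ ℤ._+_ (G-one b) (G-one c)) ⟩
    G b 1 ℤ.+ G c 1   ∎
  additive (suc m) b c e eq = begin
    G e (suc (suc m))
      ≡⟨ expand m e ⟩
    e 0 * D - G (shift e) (suc m)
      ≡⟨ cong₂ (λ u v → u * D - v) (eq 0)
               (additive m (shift b) (shift c) (shift e) (λ k → eq (suc k))) ⟩
    (b 0 ℤ.+ c 0) * D - (G (shift b) (suc m) ℤ.+ G (shift c) (suc m))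
      ≡⟨ regroup (b 0) (c 0) D (G (shift b) (suc m)) (G (shift c) (suc m)) ⟩
    (b 0 * D - G (shift b) (suc m)) ℤ.+ (c 0 * D - G (shift c) (suc m))
      ≡⟨ sym (cong₂ ℤ._+_ (expand m b) (expand m c)) ⟩
    G b (suc (suc m)) ℤ.+ G c (suc (suc m)) ∎
    where
    D : ℤ
    D = G tail (suc m)
    regroup : ∀ x y D u v → (x ℤ.+ y) * D - (u ℤ.+ v) ≡ (x * D - u) ℤ.+ (y * D - v)
    regroup = solve-∀

  additive₃ : ∀ m (b c d e : ℕ → ℤ) → (∀ k → e k ≡ b k ℤ.+ c k ℤ.+ d k) →
              G e (suc m) ≡ G b (suc m) ℤ.+ G c (suc m) ℤ.+ G d (suc m)
  additive₃ m b c d e eq = begin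
    G e (suc m)                                     ≡⟨ additive m bc d e eq ⟩
    G bc (suc m) ℤ.+ G d (suc m)                    ≡⟨ cong (ℤ._+ G d (suc m)) (additive m b c bc (λ _ → refl)) ⟩
    G b (suc m) ℤ.+ G c (suc m) ℤ.+ G d (suc m)     ∎
    where
    bc : ℕ → ℤ
    bc k = b k ℤ.+ c k

module TribFib = Bordered (withHead1 trib) refl

-- Since T₀ = T₁ = 0, two expansions lose their leading term.
vanishing-lead : ∀ D s f → + 0 * D - s * f ≡ - s * f
vanishing-lead = solve-∀

trib-bordered-fib : ∀ k → TribFib.G (shift trib) (suc k) ≡ sign k * fib k
                        × TribFib.G (shift (shift trib)) (suc k) ≡ sign k * fib (suc k)
trib-bordered-fib zero = TribFib.G-one (shift trib) , TribFib.G-one (shift (shift trib))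
trib-bordered-fib (suc k) with trib-bordered-fib k
... | ih₁ , ih₂ = from-T₁ , from-T₂
  where
  open TribFib using (G; expand; additive₃)
  T₁ T₂ T₃ : ℕ → ℤ
  T₁ = shift trib
  T₂ = shift T₁
  T₃ = shift T₂
  D : ℤ
  D = G trib (suc k)

  from-T₁ : G T₁ (suc (suc k)) ≡ sign (suc k) * fib (suc k)
  from-T₁ = begin
    G T₁ (suc (suc k))               ≡⟨ expand k T₁ ⟩
    + 0 * D - G T₂ (suc k)           ≡⟨ cong (λ v → + 0 * D - v) ih₂ ⟩
    + 0 * D - sign k * fib (suc k)   ≡⟨ vanishing-lead D (sign k) (fib (suc k)) ⟩
    - sign k * fib (suc k)           ∎

  from-T₂ : G T₂ (suc (suc k)) ≡ sign (suc k) * fib (suc (suc k))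
  from-T₂ = begin
    G T₂ (suc (suc k))
      ≡⟨ expand k T₂ ⟩
    + 1 * D - G T₃ (suc k)
      ≡⟨ cong (λ v → + 1 * D - v) (additive₃ k T₂ T₁ trib T₃ (λ _ → refl)) ⟩
    + 1 * D - (G T₂ (suc k) ℤ.+ G T₁ (suc k) ℤ.+ D)
      ≡⟨ cong₂ (λ u v → + 1 * D - (u ℤ.+ v ℤ.+ D)) ih₂ ih₁ ⟩
    + 1 * D - (sign k * fib (suc k) ℤ.+ sign k * fib k ℤ.+ D)
      ≡⟨ identity D (sign k) (fib k) (fib (suc k)) ⟩
    - sign k * (fib (suc k) ℤ.+ fib k) ∎
    where
    identity : ∀ D s f₀ f₁ → + 1 * D - (s * f₁ ℤ.+ s * f₀ ℤ.+ D) ≡ - s * (f₁ ℤ.+ f₀)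
    identity = solve-∀

tribonacci-fibonacci : (n : ℕ) → 2 ≤ n → detTH (withHead1 trib) n ≡ sign (n ∸ 1) * fib (n ∸ 2)
tribonacci-fibonacci (suc (suc k)) (s≤s (s≤s _)) = begin
  detTH (withHead1 trib) (suc (suc k))  ≡⟨ TribFib.detTH≡G (suc (suc k)) ⟩
  G trib (suc (suc k))                  ≡⟨ TribFib.expand k trib ⟩
  + 0 * D - G (shift trib) (suc k)      ≡⟨ cong (λ v → + 0 * D - v) (proj₁ (trib-bordered-fib k)) ⟩
  + 0 * D - sign k * fib k              ≡⟨ vanishing-lead D (sign k) (fib k) ⟩
  - sign k * fib k                      ∎
  where
  open TribFib using (G)
  D : ℤ
  D = G trib (suc k)

module TribPad = Bordered (withHead1 (λ k → trib (k + 2))) refl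

-- Bordering by U₀, U₁, U₂ gives signed Padovan numbers P_{k+3}, P_{k+6},
-- P_{k+8}; the recurrences below use P_{j+3} = P_{j+1} + P_j throughout.
trib-bordered-pad : ∀ k → TribPad.G TribPad.tail (suc k) ≡ sign k * pad (3 + k)
                        × TribPad.G (shift TribPad.tail) (suc k) ≡ sign k * pad (6 + k)
                        × TribPad.G (shift (shift TribPad.tail)) (suc k) ≡ sign k * pad (8 + k)
trib-bordered-pad zero =
  G-one U₀ , G-one (shift U₀) , G-one (shift (shift U₀))
  where open TribPad using (G-one) renaming (tail to U₀)
trib-bordered-pad (suc k) with trib-bordered-pad k
... | ih₀ , ih₁ , ih₂ = from-U₀ , from-U₁ , from-U₂
  where
  open TribPad using (G; expand; additive₃) renaming (tail to U₀)
  U₁ U₂ U₃ : ℕ → ℤ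
  U₁ = shift U₀
  U₂ = shift U₁
  U₃ = shift U₂
  s : ℤ
  s = sign k

  from-U₀ : G U₀ (suc (suc k)) ≡ sign (suc k) * pad (4 + k)
  from-U₀ = begin
    G U₀ (suc (suc k))                        ≡⟨ expand k U₀ ⟩
    + 1 * G U₀ (suc k) - G U₁ (suc k)         ≡⟨ cong₂ (λ u v → + 1 * u - v) ih₀ ih₁ ⟩
    + 1 * (s * pad (3 + k)) - s * pad (6 + k) ≡⟨ identity s (pad (3 + k)) (pad (4 + k)) ⟩
    - s * pad (4 + k)                         ∎
    where
    identity : ∀ s p₃ p₄ → + 1 * (s * p₃) - s * (p₄ ℤ.+ p₃) ≡ - s * p₄
    identity = solve-∀

  from-U₁ : G U₁ (suc (suc k)) ≡ sign (suc k) * pad (7 + k)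
  from-U₁ = begin
    G U₁ (suc (suc k))                        ≡⟨ expand k U₁ ⟩
    + 1 * G U₀ (suc k) - G U₂ (suc k)         ≡⟨ cong₂ (λ u v → + 1 * u - v) ih₀ ih₂ ⟩
    + 1 * (s * pad (3 + k)) - s * pad (8 + k) ≡⟨ identity s (pad (3 + k)) (pad (4 + k)) (pad (5 + k)) ⟩
    - s * pad (7 + k)                         ∎
    where
    identity : ∀ s p₃ p₄ p₅ →
               + 1 * (s * p₃) - s * ((p₄ ℤ.+ p₃) ℤ.+ p₅) ≡ - s * (p₅ ℤ.+ p₄)
    identity = solve-∀

  from-U₂ : G U₂ (suc (suc k)) ≡ sign (suc k) * pad (9 + k)
  from-U₂ = begin
    G U₂ (suc (suc k))
      ≡⟨ expand k U₂ ⟩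
    + 2 * G U₀ (suc k) - G U₃ (suc k)
      ≡⟨ cong (λ v → + 2 * G U₀ (suc k) - v) (additive₃ k U₂ U₁ U₀ U₃ (λ _ → refl)) ⟩
    + 2 * G U₀ (suc k) - (G U₂ (suc k) ℤ.+ G U₁ (suc k) ℤ.+ G U₀ (suc k))
      ≡⟨ cong₂ (λ u v → + 2 * u - (v ℤ.+ G U₁ (suc k) ℤ.+ u)) ih₀ ih₂ ⟩
    + 2 * (s * pad (3 + k)) - (s * pad (8 + k) ℤ.+ G U₁ (suc k) ℤ.+ s * pad (3 + k))
      ≡⟨ cong (λ v → + 2 * (s * pad (3 + k)) - (s * pad (8 + k) ℤ.+ v ℤ.+ s * pad (3 + k))) ih₁ ⟩
    + 2 * (s * pad (3 + k)) - (s * pad (8 + k) ℤ.+ s * pad (6 + k) ℤ.+ s * pad (3 + k))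
      ≡⟨ identity s (pad (3 + k)) (pad (4 + k)) (pad (5 + k)) ⟩
    - s * pad (9 + k) ∎
    where
    identity : ∀ s p₃ p₄ p₅ →
               + 2 * (s * p₃) - (s * ((p₄ ℤ.+ p₃) ℤ.+ p₅) ℤ.+ s * (p₄ ℤ.+ p₃) ℤ.+ s * p₃)
               ≡ - s * ((p₅ ℤ.+ p₄) ℤ.+ (p₄ ℤ.+ p₃))
    identity = solve-∀

tribonacci-padovan : (n : ℕ) → 1 ≤ n →
                     detTH (withHead1 (λ k → trib (k + 2))) n ≡ sign (n ∸ 1) * pad (n + 2)
tribonacci-padovan (suc k) (s≤s _) = begin
  detTH (withHead1 (λ k → trib (k + 2))) (suc k)  ≡⟨ TribPad.detTH≡G (suc k) ⟩
  TribPad.G TribPad.tail (suc k)                   ≡⟨ proj₁ (trib-bordered-pad k) ⟩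
  sign k * pad (3 + k)                             ≡⟨ cong (λ t → sign k * pad (suc t)) (+-comm 2 k) ⟩
  sign k * pad (suc k + 2)                         ∎

theorem2 : ((n : ℕ) → 2 ≤ n → detTH (withHead1 trib) n ≡ sign (n ∸ 1) * fib (n ∸ 2))
    × ((n : ℕ) → 1 ≤ n → detTH (withHead1 (λ k → trib (k + 2))) n ≡ sign (n ∸ 1) * pad (n + 2))
theorem2 = tribonacci-fibonacci , tribonacci-padovan
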